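{- Let $G$ be a finite simple graph that has a pendant vertex (a vertex of degree $1$). Then $d_{\rm st}(G)=1$ or $d_{\rm st}(G)=2$.
   Context: For a finite simple graph $G=(V,E)$, a set $D\subseteq V$ is a strong dominating set if for every vertex $x\in V\setminus D$ there is a vertex $y\in D$ with $xy\in E$ and $\deg(x)\le \deg(y)$. A strong domatic partition of $G$ is a partition of $V(G)$ all of whose classes are strong dominating sets of $G$. The strong domatic number $d_{\rm st}(G)$ is the maximum number of classes of a strong domatic partition of $G$. -}

module Defs where

open import Data.Nat using (ℕ; _≤_)
open import Data.Fin using (Fin)
open import Data.Bool using (Bool; true; false; T)
open import Data.List using (length; filter; allFin)
open import Data.Product using (Σ; _×_; ∃)
open import Relation.Nullary using (¬_)
open import Relation.Nullary.Decidable using (T?)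
open import Relation.Binary.PropositionalEquality using (_≡_)
open import Function.Definitions using (Surjective)

record Graph (n : ℕ) : Set where
  field
    adj   : Fin n → Fin n → Bool
    sym   : ∀ x y → adj x y ≡ adj y x
    irref : ∀ x → adj x x ≡ false
open Graph public

deg : ∀ {n} → Graph n → Fin n → ℕ
deg {n} G x = length (filter (λ y → T? (adj G x y)) (allFin n))

HasPendant : ∀ {n} → Graph n → Set
HasPendant G = ∃ λ v → deg G v ≡ 1

StrongDominating : ∀ {n} → Graph n → (Fin n → Set) → Set
StrongDominating {n} G D =
  ∀ x → ¬ D x → Σ (Fin n) λ y → D y × T (adj G x y) × deg G x ≤ deg G y

-- a strong domatic partition with k classes: a surjective class assignment
-- c : V → Fin k (so all k classes are nonempty), each class strong dominating
StrongDomaticPartition : ∀ {n} → Graph n → (k : ℕ) → Set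
StrongDomaticPartition {n} G k =
  Σ (Fin n → Fin k) λ c →
    Surjective _≡_ _≡_ c × (∀ i → StrongDominating G (λ x → c x ≡ i))

IsStrongDomaticNumber : ∀ {n} → Graph n → ℕ → Set
IsStrongDomaticNumber G d =
  StrongDomaticPartition G d × (∀ k → StrongDomaticPartition G k → k ≤ d)

-- A pendant vertex v with neighbour u is strongly dominated only through u, so every class of a
-- strong domatic partition contains v or u; hence there are at most two classes. The whole vertex
-- set is always a single class, and whether two classes are possible is decided by exhaustive
-- search over the finitely many class assignments.
module Submission where

open import Defs hiding (sym)
open import Data.Nat using (ℕ; _≤_; _≤?_)
open import Data.Nat.Properties using (≤-pred; ≤∧≢⇒<)
open import Data.Fin using (Fin; zero; suc; _≟_)
open import Data.Fin.Properties using (any?; all?; injective⇒≤)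
import Data.Vec.Functional as Vector
open import Data.Bool using (T)
open import Data.List using (List; []; _∷_; length; filter; allFin)
open import Data.List.Membership.Propositional using (_∈_)
open import Data.List.Membership.Propositional.Properties using (∈-allFin; ∈-filter⁺; ∈-filter⁻)
open import Data.List.Relation.Unary.Any using (here; there)
open import Data.Product using (_×_; ∃; _,_; proj₁; proj₂)
open import Data.Sum using (_⊎_; inj₁; inj₂; [_,_]′)
open import Relation.Nullary using (Dec; yes; no; contradiction)
open import Relation.Nullary.Decidable using (T?; map′; ¬?; _×-dec_; _→-dec_)
open import Level using (0ℓ)
open import Relation.Unary using (Pred; Decidable)
open import Relation.Binary.Definitions using (_Respects_)
open import Relation.Binary.PropositionalEquality using (_≡_; _≗_; refl; sym; trans; cong)
open import Function.Definitions using (Surjective; Injective)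

length≡1⇒unique-∈ : ∀ {A : Set} (xs : List A) → length xs ≡ 1 →
  ∃ λ u → u ∈ xs × (∀ {y} → y ∈ xs → y ≡ u)
length≡1⇒unique-∈ (u ∷ []) refl = u , here refl , λ { (here y≡u) → y≡u ; (there ()) }

covered-by-two⇒≤2 : ∀ {k} (a b : Fin k) → (∀ i → i ≡ a ⊎ i ≡ b) → k ≤ 2
covered-by-two⇒≤2 {k} a b cover = injective⇒≤ {f = side} side-injective
  where
  side : Fin k → Fin 2
  side i = [ (λ _ → zero) , (λ _ → suc zero) ]′ (cover i)

  side-injective : Injective _≡_ _≡_ side
  side-injective {i} {j} eq with cover i | cover j
  ... | inj₁ i≡a | inj₁ j≡a = trans i≡a (sym j≡a)
  ... | inj₂ i≡b | inj₂ j≡b = trans i≡b (sym j≡b)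
  ... | inj₁ _   | inj₂ _   with () ← eq
  ... | inj₂ _   | inj₁ _   with () ← eq

anyFunction? : ∀ n {k p} {P : Pred (Fin n → Fin k) p} →
  P Respects _≗_ → Decidable P → Dec (∃ P)
anyFunction? ℕ.zero {P = P} resp P? with P? (λ ())
... | yes p = yes (_ , p)
... | no ¬p = no λ (f , pf) → ¬p (resp (λ ()) pf)
anyFunction? (ℕ.suc n) {P = P} resp P? =
  map′ (λ (a , f , p) → a Vector.∷ f , p)
       (λ (f , p) → Vector.head f , Vector.tail f , resp head∷tail p)
       (any? λ a → anyFunction? n (λ f≗g → resp (∷-cong a f≗g)) (λ f → P? (a Vector.∷ f)))
  where
  head∷tail : ∀ {f : Fin (ℕ.suc n) → _} → f ≗ Vector.head f Vector.∷ Vector.tail f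
  head∷tail zero    = refl
  head∷tail (suc i) = refl

  ∷-cong : ∀ a {f g} → f ≗ g → a Vector.∷ f ≗ a Vector.∷ g
  ∷-cong a f≗g zero    = refl
  ∷-cong a f≗g (suc i) = f≗g i

module _ {n} (G : Graph n) where

  neighbours : Fin n → List (Fin n)
  neighbours v = filter (λ y → T? (adj G v y)) (allFin n)

  pendant⇒unique-neighbour : ∀ {v} → deg G v ≡ 1 →
    ∃ λ u → T (adj G v u) × (∀ y → T (adj G v y) → y ≡ u)
  pendant⇒unique-neighbour {v} deg≡1 with u , u∈ , unique ← length≡1⇒unique-∈ (neighbours v) deg≡1 =
    u , proj₂ (∈-filter⁻ (λ y → T? (adj G v y)) {xs = allFin n} u∈) ,
    λ y v~y → unique (∈-filter⁺ (λ y → T? (adj G v y)) (∈-allFin y) v~y)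

  strongDominating? : ∀ {D : Fin n → Set} → Decidable D → Dec (StrongDominating G D)
  strongDominating? D? = all? λ x → ¬? (D? x) →-dec
    any? λ y → D? y ×-dec T? (adj G x y) ×-dec deg G x ≤? deg G y

  IsStrongDomatic : ∀ {k} → Pred (Fin n → Fin k) 0ℓ
  IsStrongDomatic c = Surjective _≡_ _≡_ c × (∀ i → StrongDominating G (λ x → c x ≡ i))

  isStrongDomatic-resp-≗ : ∀ {k} → IsStrongDomatic {k} Respects _≗_
  isStrongDomatic-resp-≗ {x = c} {y = c′} c≗c′ (surj , dom) = surj′ , dom′
    where
    surj′ : Surjective _≡_ _≡_ c′
    surj′ i with x , cx≡i ← surj i = x , λ { refl → trans (sym (c≗c′ x)) (cx≡i refl) }

    dom′ : ∀ i → StrongDominating G (λ x → c′ x ≡ i)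
    dom′ i x c′x≢i with y , cy≡i , x~y , deg≤ ← dom i x (λ cx≡i → c′x≢i (trans (sym (c≗c′ x)) cx≡i)) =
      y , trans (sym (c≗c′ y)) cy≡i , x~y , deg≤

  isStrongDomatic? : ∀ {k} → Decidable (IsStrongDomatic {k})
  isStrongDomatic? c = surjective? ×-dec all? λ i → strongDominating? λ x → c x ≟ i
    where
    surjective? : Dec (Surjective _≡_ _≡_ c)
    surjective? = map′ (λ hit i → proj₁ (hit i) , λ { refl → proj₂ (hit i) })
                       (λ surj i → proj₁ (surj i) , proj₂ (surj i) refl)
                       (all? λ i → any? λ x → c x ≟ i)

  strongDomaticPartition? : ∀ k → Dec (StrongDomaticPartition G k)
  strongDomaticPartition? k = anyFunction? n isStrongDomatic-resp-≗ isStrongDomatic?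

  trivialStrongDomaticPartition : Fin n → StrongDomaticPartition G 1
  trivialStrongDomaticPartition v =
    (λ _ → zero) , (λ { zero → v , λ _ → refl }) , λ { zero x x∉V → contradiction refl x∉V }

  strongDominating-class-at-leaf : ∀ {k} {c : Fin n → Fin k} →
    (∀ i → StrongDominating G (λ x → c x ≡ i)) →
    ∀ {v u} → (∀ y → T (adj G v y) → y ≡ u) → ∀ i → i ≡ c v ⊎ i ≡ c u
  strongDominating-class-at-leaf {c = c} dom {v} only-u i with i ≟ c v
  ... | yes i≡cv = inj₁ i≡cv
  ... | no  i≢cv with y , cy≡i , v~y , _ ← dom i v (λ cv≡i → i≢cv (sym cv≡i)) =
    inj₂ (trans (sym cy≡i) (cong c (only-u y v~y)))

  pendant⇒strongDomaticPartition-≤2 : HasPendant G → ∀ k → StrongDomaticPartition G k → k ≤ 2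
  pendant⇒strongDomaticPartition-≤2 (v , deg≡1) k (c , _ , dom)
    with u , _ , only-u ← pendant⇒unique-neighbour deg≡1 =
    covered-by-two⇒≤2 (c v) (c u) (strongDominating-class-at-leaf dom only-u)

theorem2p1 : ∀ {n : ℕ} (G : Graph n) → HasPendant G →
    IsStrongDomaticNumber G 1 ⊎ IsStrongDomaticNumber G 2
theorem2p1 G pendant@(v , _) with strongDomaticPartition? G 2
... | yes two = inj₂ (two , pendant⇒strongDomaticPartition-≤2 G pendant)
... | no ¬two = inj₁ (trivialStrongDomaticPartition G v , ≤1)
  where
  ≤1 : ∀ k → StrongDomaticPartition G k → k ≤ 1
  ≤1 k pk = ≤-pred (≤∧≢⇒< (pendant⇒strongDomaticPartition-≤2 G pendant k pk) λ { refl → ¬two pk })
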